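{- Let $N,k,e\in\mathbb{N}$ and let $r$ be an odd prime with $\gcd(Nk,r)=1$. Then every element of $\mathcal{L}_{N,r^{e+1},k}$ reduces modulo $r^e$ to an element of $\mathcal{L}_{N,r^e,k}$. For $a\in\mathcal{L}_{N,r^e,k}$ let $\#_a$ be the number of elements of $\mathcal{L}_{N,r^{e+1},k}$ that reduce to $a$ modulo $r^e$. Then \[ \#_a=\begin{cases} r & \text{if } \nu_a<e/2,\\ (r+1)/2 & \text{if } \nu_a=e/2,\\ 1 & \text{if } \nu_a>e/2.\end{cases} \]
   Context: $\mathcal{H}_{N,m}:=\{(x,y)\in(\mathbb{Z}/m\mathbb{Z})^2: xy\equiv N \bmod m\}$ and, for $\gcd(Nk,m)=1$, $\mathcal{L}_{N,m,k}:=\{kx+y\bmod m:(x,y)\in\mathcal{H}_{N,m}\}$. For $a\in\mathcal{L}_{N,r^e,k}$ let $\mathcal{P}_a:=\{(x,y)\in\mathcal{H}_{N,r^e}: a\equiv kx+y\bmod r^e\}$. For $(x,y)\in\mathcal{P}_a$, $\nu_r(kx-y)$ denotes the $r$-adic valuation of $kx-y$, i.e. the largest $j\in\{0,\dots,e\}$ with $r^j\mid kx-y$ (well defined modulo $r^e$). The $\nu$-value of $a$ is $\nu_a:=\min\{\nu_r(kx-y):(x,y)\in\mathcal{P}_a\}$. -}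

module Defs where

open import Data.Nat using (ℕ; _+_; _*_; _^_; _≤_; ∣_-_∣)
open import Data.Nat.Divisibility using (_∣_; _∣?_)
open import Data.Fin using (Fin; toℕ)
open import Data.Fin.Properties using (any?)
open import Data.Product using (Σ; ∃; ∃-syntax; _×_; _,_)
open import Relation.Nullary using (Dec)
open import Relation.Nullary.Decidable using (_×-dec_)
open import Relation.Unary using (Pred; Decidable)
import Data.List as L

_≡_[mod_] : ℕ → ℕ → ℕ → Set
a ≡ b [mod m ] = m ∣ ∣ a - b ∣

-- Z/mZ is represented by Fin m (canonical representatives 0 … m-1).

InH : (N m : ℕ) → Fin m → Fin m → Set
InH N m x y = (toℕ x * toℕ y) ≡ N [mod m ]

InL : (N m k : ℕ) → Fin m → Set
InL N m k a = ∃[ x ] ∃[ y ] (InH N m x y × (k * toℕ x + toℕ y) ≡ toℕ a [mod m ])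

InP : (N m k : ℕ) → Fin m → Fin m → Fin m → Set
InP N m k a x y = InH N m x y × (k * toℕ x + toℕ y) ≡ toℕ a [mod m ]

-- j is the r-adic valuation ν_r(kx - y), truncated at e:
-- the largest j ∈ {0,…,e} with r^j ∣ kx - y.
IsNu : (r e k : ℕ) → Fin (r ^ e) → Fin (r ^ e) → ℕ → Set
IsNu r e k x y j =
  j ≤ e × (r ^ j) ∣ ∣ k * toℕ x - toℕ y ∣ ×
  (∀ i → i ≤ e → (r ^ i) ∣ ∣ k * toℕ x - toℕ y ∣ → i ≤ j)

IsNuVal : (N r e k : ℕ) → Fin (r ^ e) → ℕ → Set
IsNuVal N r e k a v =
  (∃[ x ] ∃[ y ] (InP N (r ^ e) k a x y × IsNu r e k x y v)) ×
  (∀ x y → InP N (r ^ e) k a x y → ∀ j → IsNu r e k x y j → v ≤ j)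

Reduces : (r e : ℕ) → Fin (r ^ (1 + e)) → Fin (r ^ e) → Set
Reduces r e b a = toℕ b ≡ toℕ a [mod r ^ e ]

InL? : (N m k : ℕ) → Decidable (InL N m k)
InL? N m k a = any? (λ x → any? (λ y →
  ((m ∣? ∣ toℕ x * toℕ y - N ∣)) ×-dec (m ∣? ∣ k * toℕ x + toℕ y - toℕ a ∣)))

Lift? : (N r e k : ℕ) (a : Fin (r ^ e)) →
        Decidable (λ (b : Fin (r ^ (1 + e))) → InL N (r ^ (1 + e)) k b × Reduces r e b a)
Lift? N r e k a b = InL? N (r ^ (1 + e)) k b ×-dec ((r ^ e) ∣? ∣ toℕ b - toℕ a ∣)

count# : (N r e k : ℕ) → Fin (r ^ e) → ℕ
count# N r e k a = L.length (L.filter (Lift? N r e k a) (L.allFin (r ^ (1 + e))))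

{-# OPTIONS --safe #-}
-- Completing the square: with w = kx − y one has w² = (kx + y)² − 4kN, so b lies in L_{N,m,k}
-- iff Δ(b) = b² − 4kN is a square mod m; for m = r^n the converse takes x = (b + w)/2k and
-- y = (b − w)/2, as 2 and k are units.  The lifts of a are b = a + s r^e (0 ≤ s < r), with
-- Δ(b) = Δ(a) + r^e (2as + s² r^e), and a pair of P_a attaining ν = ν_a gives w₀ = u r^ν with
-- w₀² ≡ Δ(a) and, when ν < e, r ∤ u.
-- If 2ν < e, the Newton step w₀ + p r^(e−ν) is a square root of Δ(b) for every s.
-- If 2ν ≥ e, then Δ(a) = d r^e and Δ(b) ≡ r^e (d + 2as) (mod r^(e+1)) with r ∤ 2a.  Now r^e c is a
-- square mod r^(e+1) iff c is a square mod r (e even) or r ∣ c (e odd); as s runs through Z/r so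
-- does d + 2as, and exactly (r+1)/2 residues are squares.  When 2ν > e, e must be odd: for e = 2t,
-- r^t is a square root of Δ(a) ≡ 0, which yields a pair of P_a with ν = t < ν_a.
module Submission where

open import Defs
open import Data.Nat as ℕ using (ℕ; zero; suc)
import Data.Nat.Properties as ℕ
open import Data.Nat.Primality using (Prime)
open import Data.Nat.Coprimality using (Coprime)
open import Data.Product using (Σ; _,_)
open import Data.Sum using (_⊎_; inj₁; inj₂)
open import Relation.Binary.PropositionalEquality using (_≡_; _≢_; refl; cong; sym; trans; subst)

parity : ∀ n → Σ ℕ λ t → n ≡ t ℕ.+ t ⊎ n ≡ suc (t ℕ.+ t)
parity zero = 0 , inj₁ refl
parity (suc n) with parity n
... | t , inj₁ n≡t+t   = t , inj₂ (cong suc n≡t+t)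
... | t , inj₂ n≡1+t+t = suc t , inj₁ (cong suc (trans n≡1+t+t (sym (ℕ.+-suc t t))))

module Counting where

  open import Data.Nat using (_+_; _*_; _<_; z≤n; s≤s)
  open import Data.Nat.Properties using (+-assoc; +-comm; suc-injective; ≤-refl; ≤-reflexive; ≤-trans;
    m≤n⇒m<n∨m≡n; m≤n⇒m≤1+n; +-monoʳ-<; *-monoˡ-≤)
  open import Data.Fin as Fin using (Fin; toℕ)
  open import Data.List using (length; filter; tabulate)
  open import Data.Product using (∃; _×_)
  open import Data.Empty using (⊥-elim)
  open import Function.Bundles using (_⇔_; mk⇔; Equivalence)
  open import Relation.Nullary using (Dec; yes; no; ¬_)
  open import Relation.Nullary.Decidable using (_⊎-dec_)
  open import Level using (0ℓ)
  open import Relation.Unary using (Pred; Decidable)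
  open import Relation.Binary.PropositionalEquality
  open import Data.Nat.Tactic.RingSolver using (solve-∀)
  open Equivalence using (to; from)

  private variable
    A B : Set
    P Q : Pred ℕ 0ℓ

  indicator : Dec A → ℕ
  indicator (yes _) = 1
  indicator (no _)  = 0

  count : Decidable P → ℕ → ℕ
  count P? zero    = 0
  count P? (suc n) = indicator (P? 0) + count (λ i → P? (suc i)) n

  indicator-cong : A ⇔ B → (A? : Dec A) (B? : Dec B) → indicator A? ≡ indicator B?
  indicator-cong A⇔B (yes _) (yes _) = refl
  indicator-cong A⇔B (yes a) (no ¬b) = ⊥-elim (¬b (to A⇔B a))
  indicator-cong A⇔B (no ¬a) (yes b) = ⊥-elim (¬a (from A⇔B b))
  indicator-cong A⇔B (no _)  (no _)  = refl

  count-cong : ∀ n (P? : Decidable P) (Q? : Decidable Q) →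
               (∀ i → i < n → P i ⇔ Q i) → count P? n ≡ count Q? n
  count-cong zero    P? Q? P⇔Q = refl
  count-cong (suc n) P? Q? P⇔Q =
    cong₂ _+_ (indicator-cong (P⇔Q 0 (s≤s z≤n)) (P? 0) (Q? 0))
              (count-cong n (λ i → P? (suc i)) (λ i → Q? (suc i)) (λ i i<n → P⇔Q (suc i) (s≤s i<n)))

  count-all : ∀ n (P? : Decidable P) → (∀ i → i < n → P i) → count P? n ≡ n
  count-all zero    P? all = refl
  count-all (suc n) P? all with P? 0
  ... | yes _  = cong suc (count-all n (λ i → P? (suc i)) (λ i i<n → all (suc i) (s≤s i<n)))
  ... | no ¬p0 = ⊥-elim (¬p0 (all 0 (s≤s z≤n)))

  count-none : ∀ n (P? : Decidable P) → (∀ i → i < n → ¬ P i) → count P? n ≡ 0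
  count-none zero    P? none = refl
  count-none (suc n) P? none with P? 0
  ... | yes p0 = ⊥-elim (none 0 (s≤s z≤n) p0)
  ... | no _   = count-none n (λ i → P? (suc i)) (λ i i<n → none (suc i) (s≤s i<n))

  count-unique : ∀ n (P? : Decidable P) {s} → s < n → P s →
                 (∀ i → i < n → P i → i ≡ s) → count P? n ≡ 1
  count-unique (suc n) P? {zero} _ p0 unique with P? 0
  ... | yes _  = cong suc (count-none n (λ i → P? (suc i)) (λ i i<n p → 1+i≢0 (unique (suc i) (s≤s i<n) p)))
    where
    1+i≢0 : ∀ {i} → suc i ≢ 0
    1+i≢0 ()
  ... | no ¬p0 = ⊥-elim (¬p0 p0)
  count-unique (suc n) P? {suc s} (s≤s s<n) ps unique with P? 0
  ... | yes p0 = ⊥-elim (0≢1+s (unique 0 (s≤s z≤n) p0))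
    where
    0≢1+s : 0 ≢ suc s
    0≢1+s ()
  ... | no _   = count-unique n (λ i → P? (suc i)) s<n ps
                   (λ i i<n p → suc-injective (unique (suc i) (s≤s i<n) p))

  count-⊎ : ∀ n (P? : Decidable P) (Q? : Decidable Q) → (∀ i → P i → ¬ Q i) →
            count (λ i → P? i ⊎-dec Q? i) n ≡ count P? n + count Q? n
  count-⊎ zero    P? Q? disjoint = refl
  count-⊎ {P = P} {Q = Q} (suc n) P? Q? disjoint =
    trans (cong₂ _+_ (indicator-⊎ (P? 0) (Q? 0))
                     (count-⊎ n (λ i → P? (suc i)) (λ i → Q? (suc i)) (λ i → disjoint (suc i))))
          (interchange (indicator (P? 0)) (indicator (Q? 0)) _ _)
    where
    indicator-⊎ : (p? : Dec (P 0)) (q? : Dec (Q 0)) → indicator (p? ⊎-dec q?) ≡ indicator p? + indicator q?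
    indicator-⊎ (yes p) (yes q) = ⊥-elim (disjoint 0 p q)
    indicator-⊎ (yes _) (no _)  = refl
    indicator-⊎ (no _)  (yes _) = refl
    indicator-⊎ (no _)  (no _)  = refl
    interchange : ∀ a b c d → (a + b) + (c + d) ≡ (a + c) + (b + d)
    interchange = solve-∀

  count-+ : ∀ m n (P? : Decidable P) → count P? (m + n) ≡ count P? m + count (λ i → P? (m + i)) n
  count-+ zero    n P? = refl
  count-+ (suc m) n P? =
    trans (cong (indicator (P? 0) +_) (count-+ m n (λ i → P? (suc i))))
          (sym (+-assoc (indicator (P? 0)) _ _))

  count-blocks : ∀ q M {a} → a < M → (P? : Decidable P) →
                 (∀ s j → s < q → j < M → P (s * M + j) → j ≡ a) →
                 count P? (q * M) ≡ count (λ s → P? (s * M + a)) q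
  count-blocks zero    M a<M P? only-a = refl
  count-blocks {P = P} (suc q) M {a} a<M P? only-a =
    trans (count-+ M (q * M) P?) (cong₂ _+_ first-block later-blocks)
    where
    first-block : count P? M ≡ indicator (P? a)
    first-block with P? a
    ... | yes pa = count-unique M P? a<M pa (λ j j<M → only-a 0 j (s≤s z≤n) j<M)
    ... | no ¬pa = count-none M P? (λ j j<M pj → ¬pa (subst P (only-a 0 j (s≤s z≤n) j<M pj) pj))
    later-blocks : count (λ i → P? (M + i)) (q * M) ≡ count (λ s → P? (suc s * M + a)) q
    later-blocks =
      trans (count-blocks q M a<M (λ i → P? (M + i))
               (λ s j s<q j<M p → only-a (suc s) j (s≤s s<q) j<M (subst P (sym (+-assoc M (s * M) j)) p)))
            (count-cong q _ _ (λ s _ → mk⇔ (subst P (sym (+-assoc M (s * M) a))) (subst P (+-assoc M (s * M) a))))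

  block-index : ∀ {q M s j} → s < q → j < M → s * M + j < q * M
  block-index {q} {M} {s} {j} s<q j<M =
    ≤-trans (+-monoʳ-< (s * M) j<M) (≤-trans (≤-reflexive (+-comm (s * M) M)) (*-monoˡ-≤ M s<q))

  ∃<-suc : ∀ j → (∃ λ z → z < suc j × P z) ⇔ ((∃ λ z → z < j × P z) ⊎ P j)
  ∃<-suc j = mk⇔ split join
    where
    split : (∃ λ z → z < suc j × P z) → (∃ λ z → z < j × P z) ⊎ P j
    split (z , s≤s z≤j , pz) with m≤n⇒m<n∨m≡n z≤j
    ... | inj₁ z<j  = inj₁ (z , z<j , pz)
    ... | inj₂ refl = inj₂ pz
    join : (∃ λ z → z < j × P z) ⊎ P j → ∃ λ z → z < suc j × P z
    join (inj₁ (z , z<j , pz)) = z , m≤n⇒m≤1+n z<j , pz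
    join (inj₂ pj)             = j , ≤-refl , pj

  length-filter-tabulate : ∀ n {X : Set} {R : Pred X 0ℓ} (R? : Decidable R) (f : Fin n → X) (P? : Decidable P) →
                           (∀ i → R (f i) ⇔ P (toℕ i)) → length (filter R? (tabulate f)) ≡ count P? n
  length-filter-tabulate zero    R? f P? R⇔P = refl
  length-filter-tabulate (suc n) R? f P? R⇔P with R? (f Fin.zero) | P? 0
  ... | yes _ | yes _  =
    cong suc (length-filter-tabulate n R? (λ i → f (Fin.suc i)) (λ i → P? (suc i)) (λ i → R⇔P (Fin.suc i)))
  ... | yes r | no ¬p = ⊥-elim (¬p (to (R⇔P Fin.zero) r))
  ... | no ¬r | yes p = ⊥-elim (¬r (from (R⇔P Fin.zero) p))
  ... | no _  | no _  = length-filter-tabulate n R? (λ i → f (Fin.suc i)) (λ i → P? (suc i)) (λ i → R⇔P (Fin.suc i))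

module Congruence where

  open import Data.Nat.Divisibility as ℕᵈ using () renaming (_∣_ to _∣ℕ_)
  open import Data.Integer using (ℤ; +_; _+_; _*_; _-_; -_; _⊖_) renaming (∣_∣ to abs)
  import Data.Integer.Properties as ℤ
  import Data.Integer.DivMod as ℤ
  open import Data.Integer.Divisibility.Signed using (_∣_; _∣?_; divides; ∣ᵤ⇒∣; ∣⇒∣ᵤ; ∣-refl; ∣-trans;
    ∣m∣n⇒∣m+n; ∣m⇒∣-m; ∣n⇒∣m*n; *-monoʳ-∣; *-monoˡ-∣)
  open import Data.Integer.Tactic.RingSolver using (solve-∀)
  open import Data.Fin using (Fin; toℕ; fromℕ<)
  open import Data.Fin.Properties using (toℕ-fromℕ<)
  open import Data.Empty using (⊥-elim)
  open import Level using (0ℓ)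
  open import Function.Bundles using (_⇔_; mk⇔)
  open import Relation.Binary.Bundles using (Setoid)
  import Relation.Binary.Reasoning.Setoid as SetoidReasoning
  open import Relation.Nullary using (Dec)
  open import Relation.Nullary.Decidable using (map′)
  open import Relation.Binary.PropositionalEquality

  infix 4 _≡_⟨mod_⟩ _≡?_⟨mod_⟩

  record _≡_⟨mod_⟩ (i j m : ℤ) : Set where
    constructor congruent
    field m∣i-j : m ∣ i - j

  open _≡_⟨mod_⟩ public

  ∣-resp-≡ : ∀ {m i j} → m ∣ i → i ≡ j → m ∣ j
  ∣-resp-≡ m∣i refl = m∣i

  mod-reflexive : ∀ {i j m} → i ≡ j → i ≡ j ⟨mod m ⟩
  mod-reflexive {i} refl = congruent (∣-resp-≡ (∣n⇒∣m*n (+ 0) ∣-refl) (sym (ℤ.+-inverseʳ i)))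

  mod-refl : ∀ {i m} → i ≡ i ⟨mod m ⟩
  mod-refl = mod-reflexive refl

  mod-sym : ∀ {i j m} → i ≡ j ⟨mod m ⟩ → j ≡ i ⟨mod m ⟩
  mod-sym {i} {j} (congruent d) = congruent (∣-resp-≡ (∣m⇒∣-m d) (negate i j))
    where
    negate : ∀ i j → - (i - j) ≡ j - i
    negate = solve-∀

  mod-trans : ∀ {i j l m} → i ≡ j ⟨mod m ⟩ → j ≡ l ⟨mod m ⟩ → i ≡ l ⟨mod m ⟩
  mod-trans {i} {j} {l} (congruent d) (congruent e) = congruent (∣-resp-≡ (∣m∣n⇒∣m+n d e) (telescope i j l))
    where
    telescope : ∀ i j l → (i - j) + (j - l) ≡ i - l
    telescope = solve-∀

  mod-+ : ∀ {i j i′ j′ m} → i ≡ j ⟨mod m ⟩ → i′ ≡ j′ ⟨mod m ⟩ → i + i′ ≡ j + j′ ⟨mod m ⟩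
  mod-+ {i} {j} {i′} {j′} (congruent d) (congruent e) =
    congruent (∣-resp-≡ (∣m∣n⇒∣m+n d e) (regroup i j i′ j′))
    where
    regroup : ∀ i j i′ j′ → (i - j) + (i′ - j′) ≡ (i + i′) - (j + j′)
    regroup = solve-∀

  mod-* : ∀ {i j i′ j′ m} → i ≡ j ⟨mod m ⟩ → i′ ≡ j′ ⟨mod m ⟩ → i * i′ ≡ j * j′ ⟨mod m ⟩
  mod-* {i} {j} {i′} {j′} (congruent d) (congruent e) =
    congruent (∣-resp-≡ (∣m∣n⇒∣m+n (∣n⇒∣m*n i′ d) (∣n⇒∣m*n j e)) (regroup i j i′ j′))
    where
    regroup : ∀ i j i′ j′ → i′ * (i - j) + j * (i′ - j′) ≡ i * i′ - j * j′
    regroup = solve-∀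

  mod-neg : ∀ {i j m} → i ≡ j ⟨mod m ⟩ → - i ≡ - j ⟨mod m ⟩
  mod-neg {i} {j} (congruent d) = congruent (∣-resp-≡ (∣m⇒∣-m d) (regroup i j))
    where
    regroup : ∀ i j → - (i - j) ≡ - i - - j
    regroup = solve-∀

  mod-weaken : ∀ {i j m n} → m ∣ n → i ≡ j ⟨mod n ⟩ → i ≡ j ⟨mod m ⟩
  mod-weaken m∣n (congruent d) = congruent (∣-trans m∣n d)

  ∣m⊖n∣≡∣m-n∣ : ∀ a b → abs (a ⊖ b) ≡ ℕ.∣ a - b ∣
  ∣m⊖n∣≡∣m-n∣ zero    zero    = refl
  ∣m⊖n∣≡∣m-n∣ zero    (suc b) = refl
  ∣m⊖n∣≡∣m-n∣ (suc a) zero    = refl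
  ∣m⊖n∣≡∣m-n∣ (suc a) (suc b) = trans (cong abs (ℤ.[1+m]⊖[1+n]≡m⊖n a b)) (∣m⊖n∣≡∣m-n∣ a b)

  ∣+m-+n∣≡∣m-n∣ : ∀ a b → abs (+ a - + b) ≡ ℕ.∣ a - b ∣
  ∣+m-+n∣≡∣m-n∣ a b = trans (cong abs (ℤ.m-n≡m⊖n a b)) (∣m⊖n∣≡∣m-n∣ a b)

  [mod]⇒⟨mod⟩ : ∀ {a b q} → a ≡ b [mod q ] → + a ≡ + b ⟨mod + q ⟩
  [mod]⇒⟨mod⟩ {a} {b} d = congruent (∣ᵤ⇒∣ (subst (_ ∣ℕ_) (sym (∣+m-+n∣≡∣m-n∣ a b)) d))

  ⟨mod⟩⇒[mod] : ∀ {a b q} → + a ≡ + b ⟨mod + q ⟩ → a ≡ b [mod q ]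
  ⟨mod⟩⇒[mod] {a} {b} (congruent d) = subst (_ ∣ℕ_) (∣+m-+n∣≡∣m-n∣ a b) (∣⇒∣ᵤ d)

  [mod]⇒≡ : ∀ {a b q} → a ℕ.< q → b ℕ.< q → a ≡ b [mod q ] → a ≡ b
  [mod]⇒≡ {a} {b} {q} a<q b<q q∣a-b with ℕ.∣ a - b ∣ in eq
  ... | zero  = ℕ.∣m-n∣≡0⇒m≡n eq
  ... | suc _ = ⊥-elim (ℕᵈ.>⇒∤ (subst (ℕ._< q) eq ∣a-b∣<q) q∣a-b)
    where
    ∣a-b∣<q : ℕ.∣ a - b ∣ ℕ.< q
    ∣a-b∣<q = ℕ.≤-<-trans (ℕ.∣m-n∣≤m⊔n a b) (ℕ.⊔-pres-<m a<q b<q)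

  multiple-shift : ∀ {q} s j → + (s ℕ.* q ℕ.+ j) ≡ + j ⟨mod + q ⟩
  multiple-shift {q} s j = congruent (divides (+ s) (trans (cong (_- + j) (trans (ℤ.pos-+ (s ℕ.* q) j)
                                                                               (cong (_+ + j) (ℤ.pos-* s q))))
                                                          (cancel (+ s * + q) (+ j))))
    where
    cancel : ∀ a b → a + b - b ≡ a
    cancel = solve-∀

  block-residue : ∀ {q j a} s → (s ℕ.* q ℕ.+ j) ≡ a [mod q ] → j ≡ a [mod q ]
  block-residue {q} {j} {a} s d = ⟨mod⟩⇒[mod] (mod-trans (mod-sym (multiple-shift s j)) ([mod]⇒⟨mod⟩ d))

  block-residue⁻ : ∀ {q a} s → (s ℕ.* q ℕ.+ a) ≡ a [mod q ]
  block-residue⁻ {q} {a} s = ⟨mod⟩⇒[mod] (multiple-shift s a)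

  reduce : ∀ q .{{_ : ℕ.NonZero q}} (z : ℤ) → Σ (Fin q) λ f → + toℕ f ≡ z ⟨mod + q ⟩
  reduce q z = fromℕ< (ℤ.n%ℕd<d z q) , mod-trans (mod-reflexive (cong +_ (toℕ-fromℕ< (ℤ.n%ℕd<d z q)))) remainder≡z
    where
    remainder≡z : + (z ℤ.%ℕ q) ≡ z ⟨mod + q ⟩
    remainder≡z = congruent (∣-resp-≡ (∣m⇒∣-m (∣n⇒∣m*n (z ℤ./ℕ q) ∣-refl)) (sym remainder-z))
      where
      cancel : ∀ ρ t → ρ - (ρ + t) ≡ - t
      cancel = solve-∀
      remainder-z : + (z ℤ.%ℕ q) - z ≡ - ((z ℤ./ℕ q) * + q)
      remainder-z = trans (cong (λ t → + (z ℤ.%ℕ q) - t) (ℤ.a≡a%ℕn+[a/ℕn]*n z q)) (cancel (+ (z ℤ.%ℕ q)) _)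

  _≡?_⟨mod_⟩ : ∀ i j m → Dec (i ≡ j ⟨mod m ⟩)
  i ≡? j ⟨mod m ⟩ = map′ congruent m∣i-j (m ∣? i - j)

  inverse-lift : ∀ {u u′ m} → u * u′ ≡ + 1 ⟨mod m ⟩ → u * (u′ * (+ 2 - u * u′)) ≡ + 1 ⟨mod m * m ⟩
  inverse-lift {u} {u′} {m} (congruent m∣uu′-1) =
    congruent (∣-resp-≡ (∣m⇒∣-m (∣-trans (*-monoʳ-∣ m m∣uu′-1) (*-monoˡ-∣ (u * u′ - + 1) m∣uu′-1)))
                        (newton u u′))
    where
    newton : ∀ u u′ → - ((u * u′ - + 1) * (u * u′ - + 1)) ≡ u * (u′ * (+ 2 - u * u′)) - + 1
    newton = solve-∀

  mod-transpose : ∀ {i j k m} → i ≡ j + k ⟨mod m ⟩ ⇔ k ≡ i - j ⟨mod m ⟩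
  mod-transpose {i} {j} {k} = mk⇔ (λ (congruent d) → congruent (∣-resp-≡ (∣m⇒∣-m d) (regroup i j k)))
                                  (λ (congruent d) → congruent (∣-resp-≡ (∣m⇒∣-m d) (regroup⁻ i j k)))
    where
    regroup : ∀ i j k → - (i - (j + k)) ≡ k - (i - j)
    regroup = solve-∀
    regroup⁻ : ∀ i j k → - (k - (i - j)) ≡ i - (j + k)
    regroup⁻ = solve-∀

  mod-setoid : ℤ → Setoid 0ℓ 0ℓ
  mod-setoid m = record
    { Carrier       = ℤ
    ; _≈_           = λ i j → i ≡ j ⟨mod m ⟩
    ; isEquivalence = record { refl = mod-refl ; sym = mod-sym ; trans = mod-trans }
    }

  module ≡-mod-Reasoning (m : ℤ) = SetoidReasoning (mod-setoid m)

  IsSquare : ℤ → ℤ → Set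
  IsSquare m z = Σ ℤ λ w → w * w ≡ z ⟨mod m ⟩

  isSquare-resp : ∀ {m z z′} → z ≡ z′ ⟨mod m ⟩ → IsSquare m z → IsSquare m z′
  isSquare-resp z≡z′ (w , w²≡z) = w , mod-trans w²≡z z≡z′

  isSquare-cong : ∀ {m z z′} → z ≡ z′ ⟨mod m ⟩ → IsSquare m z ⇔ IsSquare m z′
  isSquare-cong z≡z′ = mk⇔ (isSquare-resp z≡z′) (isSquare-resp (mod-sym z≡z′))

  ∣-cong : ∀ {m i j} → i ≡ j ⟨mod m ⟩ → m ∣ i ⇔ m ∣ j
  ∣-cong {m} {i} {j} (congruent m∣i-j) = mk⇔ to from
    where
    cancelˡ : ∀ i j → i + - (i - j) ≡ j
    cancelˡ = solve-∀
    cancelʳ : ∀ i j → i - j + j ≡ i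
    cancelʳ = solve-∀
    to : m ∣ i → m ∣ j
    to m∣i = ∣-resp-≡ (∣m∣n⇒∣m+n m∣i (∣m⇒∣-m m∣i-j)) (cancelˡ i j)
    from : m ∣ j → m ∣ i
    from m∣j = ∣-resp-≡ (∣m∣n⇒∣m+n m∣i-j m∣j) (cancelʳ i j)

  ∣m+n⇔n≡-m : ∀ {m i j} → m ∣ i + j ⇔ j ≡ - i ⟨mod m ⟩
  ∣m+n⇔n≡-m {m} {i} {j} = mk⇔ (λ m∣i+j → congruent (∣-resp-≡ m∣i+j (regroup i j)))
                                (λ j≡-i → ∣-resp-≡ (m∣i-j j≡-i) (sym (regroup i j)))
    where
    regroup : ∀ i j → i + j ≡ j - - i
    regroup = solve-∀

module PrimePower {r : ℕ} (pr : Prime r) where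

  open import Data.Nat using (⌈_/2⌉)
  open import Data.Nat.Divisibility as ℕᵈ using () renaming (_∣_ to _∣ℕ_)
  open import Data.Nat.Primality using (euclidsLemma; prime⇒irreducible; prime⇒nonZero; prime⇒nonTrivial)
  open import Data.Nat.Coprimality using (Coprime; coprime-Bézout)
  open import Data.Nat.GCD using (module Bézout)
  open import Data.Integer using (ℤ; +_; -[1+_]; _+_; _*_; _-_; -_) renaming (∣_∣ to abs)
  import Data.Integer.Properties as ℤ
  open import Data.Integer.Divisibility.Signed using (_∣_; divides; ∣ᵤ⇒∣; ∣⇒∣ᵤ; ∣-refl; ∣-trans;
    ∣m∣n⇒∣m+n; ∣m⇒∣-m; ∣n⇒∣m*n; ∣m⇒∣m*n; *-monoʳ-∣; *-cancelˡ-∣)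
  open import Data.Integer.Tactic.RingSolver using (solve-∀)
  open import Data.Nat.Tactic.RingSolver using () renaming (solve-∀ to ℕ-solve-∀)
  open import Data.Sum using ([_,_]′)
  open import Data.Empty using (⊥-elim)
  open import Function using (id)
  open import Function.Bundles using (_⇔_; mk⇔)
  open import Relation.Nullary using (¬_; yes; no)
  open import Relation.Binary.PropositionalEquality
  open import Data.Fin using (toℕ)
  open import Data.Fin.Properties using (toℕ<n)
  open Congruence
  open Counting using (count; count-unique)

  instance
    r≢0 : ℕ.NonZero r
    r≢0 = prime⇒nonZero pr

  1<r : 1 ℕ.< r
  1<r = ℕ.nonTrivial⇒n>1 r {{prime⇒nonTrivial pr}}

  r^_ : ℕ → ℤ
  r^ n = + (r ℕ.^ n)

  r^-+ : ∀ m n → r^ (m ℕ.+ n) ≡ r^ m * r^ n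
  r^-+ m n = trans (cong +_ (ℕ.^-distribˡ-+-* r m n)) (ℤ.pos-* (r ℕ.^ m) (r ℕ.^ n))

  r^-suc : ∀ n → r^ suc n ≡ + r * r^ n
  r^-suc n = ℤ.pos-* r (r ℕ.^ n)

  r^1 : r^ 1 ≡ + r
  r^1 = cong +_ (ℕ.*-identityʳ r)

  r^-mono-∣ : ∀ {m n} → m ℕ.≤ n → r^ m ∣ r^ n
  r^-mono-∣ {m} {n} m≤n =
    ∣-resp-≡ (∣m⇒∣m*n (r^ (n ℕ.∸ m)) ∣-refl) (trans (sym (r^-+ m (n ℕ.∸ m))) (cong r^_ (ℕ.m+[n∸m]≡n m≤n)))

  r^-∣-* : ∀ {m i j} → m ℕ.≤ i ℕ.+ j → r^ m ∣ r^ i * r^ j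
  r^-∣-* {m} {i} {j} m≤i+j = ∣-resp-≡ (r^-mono-∣ m≤i+j) (r^-+ i j)

  r^-sucʳ : ∀ n → r^ suc n ≡ r^ n * + r
  r^-sucʳ n = trans (r^-suc n) (ℤ.*-comm (+ r) (r^ n))

  ∣⇒r^suc∣r^* : ∀ n {x} → + r ∣ x → r^ suc n ∣ r^ n * x
  ∣⇒r^suc∣r^* n {x} r∣x = subst (_∣ r^ n * x) (sym (r^-sucʳ n)) (*-monoʳ-∣ (r^ n) r∣x)

  r^suc∣r^*⇒∣ : ∀ n {x} → r^ suc n ∣ r^ n * x → + r ∣ x
  r^suc∣r^*⇒∣ n {x} d = *-cancelˡ-∣ (r^ n) {{ℕ.m^n≢0 r n}} (subst (_∣ r^ n * x) (r^-sucʳ n) d)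

  r^suc∤r^ : ∀ t → ¬ r^ suc t ∣ r^ t
  r^suc∤r^ t d = ℕ.<⇒≱ (ℕ.^-monoʳ-< r 1<r (ℕ.n<1+n t)) (ℕᵈ.∣⇒≤ {{ℕ.m^n≢0 r t}} (∣⇒∣ᵤ d))

  ≡r^t⇒r^t∣ : ∀ {t e z} → t ℕ.≤ e → z ≡ r^ t ⟨mod r^ e ⟩ → r^ t ∣ z
  ≡r^t⇒r^t∣ {t} {e} {z} t≤e (congruent d) =
    ∣-resp-≡ (∣m∣n⇒∣m+n (∣-trans (r^-mono-∣ t≤e) d) ∣-refl) (cancel z (r^ t))
    where
    cancel : ∀ a b → a - b + b ≡ a
    cancel = solve-∀

  ≡r^t⇒exponent≤ : ∀ {t e z} → t ℕ.< e → z ≡ r^ t ⟨mod r^ e ⟩ → ∀ i → r^ i ∣ z → i ℕ.≤ t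
  ≡r^t⇒exponent≤ {t} {e} {z} t<e (congruent d) i r^i∣z with i ℕ.≤? t
  ... | yes i≤t = i≤t
  ... | no  i≰t = ⊥-elim (r^suc∤r^ t (∣-resp-≡ (∣m∣n⇒∣m+n (∣-trans (r^-mono-∣ (ℕ.≰⇒> i≰t)) r^i∣z)
                                                          (∣m⇒∣-m (∣-trans (r^-mono-∣ t<e) d)))
                                               (cancel z (r^ t))))
    where
    cancel : ∀ a b → a + - (a - b) ≡ b
    cancel = solve-∀

  euclid : ∀ a b → + r ∣ a * b → + r ∣ a ⊎ + r ∣ b
  euclid a b r∣ab with euclidsLemma (abs a) (abs b) pr (subst (r ∣ℕ_) (ℤ.abs-* a b) (∣⇒∣ᵤ r∣ab))
  ... | inj₁ r∣a = inj₁ (∣ᵤ⇒∣ r∣a)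
  ... | inj₂ r∣b = inj₂ (∣ᵤ⇒∣ r∣b)

  ∤-* : ∀ {a b} → ¬ + r ∣ a → ¬ + r ∣ b → ¬ + r ∣ a * b
  ∤-* {a} {b} r∤a r∤b r∣ab = [ r∤a , r∤b ]′ (euclid a b r∣ab)

  ∤⇒coprime : ∀ {m} → ¬ r ∣ℕ m → Coprime r m
  ∤⇒coprime r∤m (d∣r , d∣m) with prime⇒irreducible pr d∣r
  ... | inj₁ d≡1   = d≡1
  ... | inj₂ refl = ⊥-elim (r∤m d∣m)

  private
    lift-bézout : ∀ {a b c d} → 1 ℕ.+ a ℕ.* b ≡ c ℕ.* d → + 1 + + a * + b ≡ + c * + d
    lift-bézout {a} {b} {c} {d} eq =
      trans (cong (λ t → + 1 + t) (sym (ℤ.pos-* a b)))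
            (trans (sym (ℤ.pos-+ 1 (a ℕ.* b))) (trans (cong +_ eq) (ℤ.pos-* c d)))

  inverse-mod-r : ∀ {u} → ¬ + r ∣ u → Σ ℤ λ u′ → u * u′ ≡ + 1 ⟨mod + r ⟩
  inverse-mod-r {+ m} r∤u with coprime-Bézout (∤⇒coprime (λ r∣m → r∤u (∣ᵤ⇒∣ r∣m)))
  ... | Bézout.+- x y 1+ym≡xr =
    - + y , congruent (divides (- + x) (bézout (+ m) (+ y) (+ x) (lift-bézout {y} {m} {x} {r} 1+ym≡xr)))
    where
    rearrange : ∀ m y → m * (- y) - + 1 ≡ - (+ 1 + y * m)
    rearrange = solve-∀
    bézout : ∀ m y x → + 1 + y * m ≡ x * + r → m * (- y) - + 1 ≡ (- x) * + r
    bézout m y x eq = trans (rearrange m y) (trans (cong -_ eq) (ℤ.neg-distribˡ-* x (+ r)))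
  ... | Bézout.-+ x y 1+xr≡ym =
    + y , congruent (divides (+ x) (bézout (+ m) (+ y) (+ x) (lift-bézout {x} {r} {y} {m} 1+xr≡ym)))
    where
    cancel : ∀ t → + 1 + t - + 1 ≡ t
    cancel = solve-∀
    bézout : ∀ m y x → + 1 + x * + r ≡ y * m → m * y - + 1 ≡ x * + r
    bézout m y x eq = trans (cong (λ t → t - + 1) (trans (ℤ.*-comm m y) (sym eq))) (cancel (x * + r))
  inverse-mod-r { -[1+ n ]} r∤u with inverse-mod-r {+ suc n} (λ r∣n → r∤u (∣ᵤ⇒∣ (∣⇒∣ᵤ r∣n)))
  ... | u′ , uu′≡1 = - u′ , mod-trans (mod-reflexive (negate (+ suc n) u′)) uu′≡1
    where
    negate : ∀ a b → - a * - b ≡ a * b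
    negate = solve-∀

  inverse-mod-r^ : ∀ {u} → ¬ + r ∣ u → ∀ n → Σ ℤ λ u′ → u * u′ ≡ + 1 ⟨mod r^ suc n ⟩
  inverse-mod-r^ {u} r∤u zero with inverse-mod-r r∤u
  ... | u′ , uu′≡1 = u′ , subst (λ m → u * u′ ≡ + 1 ⟨mod m ⟩) (sym r^1) uu′≡1
  inverse-mod-r^ {u} r∤u (suc n) with inverse-mod-r^ r∤u n
  ... | u′ , uu′≡1 = u′ * (+ 2 - u * u′) ,
                     mod-weaken (r^-∣-* {suc (suc n)} {suc n} {suc n} (ℕ.s≤s (ℕ.m≤n+m (suc n) n)))
                                (inverse-lift {u} {u′} {r^ suc n} uu′≡1)

  r∣n²⇒r∣n : ∀ w → r ∣ℕ w ℕ.* w → r ∣ℕ w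
  r∣n²⇒r∣n w r∣w² = [ id , id ]′ (euclidsLemma w w pr r∣w²)

  r^n∣m²⇒r^⌈n/2⌉∣m : ∀ n w → r ℕ.^ n ∣ℕ w ℕ.* w → r ℕ.^ ⌈ n /2⌉ ∣ℕ w
  r^n∣m²⇒r^⌈n/2⌉∣m zero          w _      = ℕᵈ.1∣ w
  r^n∣m²⇒r^⌈n/2⌉∣m (suc zero)    w r∣w² =
    subst (_∣ℕ w) (sym (ℕ.*-identityʳ r)) (r∣n²⇒r∣n w (subst (_∣ℕ w ℕ.* w) (ℕ.*-identityʳ r) r∣w²))
  r^n∣m²⇒r^⌈n/2⌉∣m (suc (suc n)) w r^n∣w² with r∣n²⇒r∣n w (ℕᵈ.∣-trans (ℕᵈ.m∣m*n _) r^n∣w²)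
  ... | ℕᵈ.divides-refl c =
    subst (r ℕ.* r ℕ.^ ⌈ n /2⌉ ∣ℕ_) (ℕ.*-comm r c) (ℕᵈ.*-monoʳ-∣ r (r^n∣m²⇒r^⌈n/2⌉∣m n c r^n∣c²))
    where
    square-of-product : ∀ c r → (c ℕ.* r) ℕ.* (c ℕ.* r) ≡ (r ℕ.* r) ℕ.* (c ℕ.* c)
    square-of-product = ℕ-solve-∀
    r^n∣c² : r ℕ.^ n ∣ℕ c ℕ.* c
    r^n∣c² = ℕᵈ.*-cancelˡ-∣ (r ℕ.* r) {{ℕ.m*n≢0 r r}}
               (subst₂ _∣ℕ_ (sym (ℕ.*-assoc r r (r ℕ.^ n))) (square-of-product c r) r^n∣w²)

  r^n∣w²⇒r^⌈n/2⌉∣w : ∀ n w → r^ n ∣ w * w → r^ ⌈ n /2⌉ ∣ w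
  r^n∣w²⇒r^⌈n/2⌉∣w n w d =
    ∣ᵤ⇒∣ (r^n∣m²⇒r^⌈n/2⌉∣m n (abs w) (subst (_ ∣ℕ_) (ℤ.abs-* w w) (∣⇒∣ᵤ d)))

  w²≡r^n*c⇒r^n∣w² : ∀ n w c → w * w ≡ r^ n * c ⟨mod r^ suc n ⟩ → r^ n ∣ w * w
  w²≡r^n*c⇒r^n∣w² n w c (congruent d) =
    ∣-resp-≡ (∣m∣n⇒∣m+n (∣-trans (r^-mono-∣ (ℕ.n≤1+n n)) d) (∣m⇒∣m*n c ∣-refl)) (cancel (w * w) (r^ n * c))
    where
    cancel : ∀ a b → a - b + b ≡ a
    cancel = solve-∀

  private
    square-shift : ∀ t z c → (z * r^ t) * (z * r^ t) - r^ (t ℕ.+ t) * c ≡ r^ (t ℕ.+ t) * (z * z - c)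
    square-shift t z c =
      trans (cong (λ P → (z * r^ t) * (z * r^ t) - P * c) (r^-+ t t))
            (trans (regroup z (r^ t) c) (cong (λ P → P * (z * z - c)) (sym (r^-+ t t))))
      where
      regroup : ∀ z P c → (z * P) * (z * P) - (P * P) * c ≡ (P * P) * (z * z - c)
      regroup = solve-∀

  isSquare-r^even : ∀ {n} t → n ≡ t ℕ.+ t → ∀ c → IsSquare (r^ suc n) (r^ n * c) ⇔ IsSquare (+ r) c
  isSquare-r^even t refl c = mk⇔ to from
    where
    to : IsSquare (r^ suc (t ℕ.+ t)) (r^ (t ℕ.+ t) * c) → IsSquare (+ r) c
    to (w , w²≡r^2t*c) with subst (λ i → r^ i ∣ w) (sym (ℕ.n≡⌈n+n/2⌉ t))
                                  (r^n∣w²⇒r^⌈n/2⌉∣w (t ℕ.+ t) w (w²≡r^n*c⇒r^n∣w² (t ℕ.+ t) w c w²≡r^2t*c))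
    ... | divides z refl = z , congruent (r^suc∣r^*⇒∣ (t ℕ.+ t) (∣-resp-≡ (m∣i-j w²≡r^2t*c) (square-shift t z c)))
    from : IsSquare (+ r) c → IsSquare (r^ suc (t ℕ.+ t)) (r^ (t ℕ.+ t) * c)
    from (z , congruent r∣z²-c) =
      z * r^ t , congruent (∣-resp-≡ (∣⇒r^suc∣r^* (t ℕ.+ t) r∣z²-c) (sym (square-shift t z c)))

  isSquare-r^odd : ∀ {n} t → n ≡ suc (t ℕ.+ t) → ∀ c → IsSquare (r^ suc n) (r^ n * c) ⇔ + r ∣ c
  isSquare-r^odd {n} t refl c = mk⇔ to from
    where
    to : IsSquare (r^ suc n) (r^ n * c) → + r ∣ c
    to (w , w²≡r^n*c) with subst (λ i → r^ i ∣ w) (cong suc (sym (ℕ.n≡⌊n+n/2⌋ t)))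
                                 (r^n∣w²⇒r^⌈n/2⌉∣w n w (w²≡r^n*c⇒r^n∣w² n w c w²≡r^n*c))
    ... | divides z refl =
      r^suc∣r^*⇒∣ n (∣-resp-≡ (∣m∣n⇒∣m+n r^suc∣w² (∣m⇒∣-m (m∣i-j w²≡r^n*c)))
                              (cancel (z * r^ suc t * (z * r^ suc t)) (r^ n * c)))
      where
      r^suc∣w² : r^ suc n ∣ (z * r^ suc t) * (z * r^ suc t)
      r^suc∣w² = ∣-resp-≡ (∣n⇒∣m*n (z * z) (r^-∣-* {suc n} {suc t} {suc t} 2+2t≤[1+t]+[1+t])) (regroup z (r^ suc t))
        where
        2+2t≤[1+t]+[1+t] : suc n ℕ.≤ suc t ℕ.+ suc t
        2+2t≤[1+t]+[1+t] = ℕ.≤-reflexive (cong suc (sym (ℕ.+-suc t t)))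
        regroup : ∀ z P → (z * z) * (P * P) ≡ (z * P) * (z * P)
        regroup = solve-∀
      cancel : ∀ a b → a + - (a - b) ≡ b
      cancel = solve-∀
    from : + r ∣ c → IsSquare (r^ suc n) (r^ n * c)
    from r∣c = + 0 , congruent (∣-resp-≡ (∣m⇒∣-m (∣⇒r^suc∣r^* n r∣c)) (zero-square (r^ n * c)))
      where
      zero-square : ∀ a → - a ≡ + 0 * + 0 - a
      zero-square = solve-∀

  count-linear : ∀ {α} → ¬ + r ∣ α → ∀ c → count (λ s → α * + s ≡? c ⟨mod + r ⟩) r ≡ 1
  count-linear {α} r∤α c with inverse-mod-r r∤α
  ... | ι , αι≡1 with reduce r (ι * c)
  ...   | s₀ , s₀≡ιc = count-unique r (λ s → α * + s ≡? c ⟨mod + r ⟩) (toℕ<n s₀) αs₀≡c unique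
    where
    αs₀≡c : α * + toℕ s₀ ≡ c ⟨mod + r ⟩
    αs₀≡c = begin
      α * + toℕ s₀  ≈⟨ mod-* (mod-refl {α}) s₀≡ιc ⟩
      α * (ι * c)   ≡⟨ ℤ.*-assoc α ι c ⟨
      α * ι * c     ≈⟨ mod-* αι≡1 (mod-refl {c}) ⟩
      + 1 * c       ≡⟨ ℤ.*-identityˡ c ⟩
      c             ∎
      where open ≡-mod-Reasoning (+ r)
    unique : ∀ s → s ℕ.< r → α * + s ≡ c ⟨mod + r ⟩ → s ≡ toℕ s₀
    unique s s<r αs≡c = [mod]⇒≡ s<r (toℕ<n s₀) (⟨mod⟩⇒[mod] {s} {toℕ s₀} (congruent r∣s-s₀))
      where
      factor : ∀ α s s₀ c → (α * s - c) + - (α * s₀ - c) ≡ α * (s - s₀)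
      factor = solve-∀
      r∣α[s-s₀] : + r ∣ α * (+ s - + toℕ s₀)
      r∣α[s-s₀] = ∣-resp-≡ (∣m∣n⇒∣m+n (m∣i-j αs≡c) (∣m⇒∣-m (m∣i-j αs₀≡c)))
                           (factor α (+ s) (+ toℕ s₀) c)
      r∣s-s₀ : + r ∣ + s - + toℕ s₀
      r∣s-s₀ = [ (λ r∣α → ⊥-elim (r∤α r∣α)) , id ]′ (euclid α (+ s - + toℕ s₀) r∣α[s-s₀])

module OddPrime {r : ℕ} (pr : Prime r) (r≢2 : r ≢ 2) where

  open import Data.Nat using (_≤_; _<_; z≤n; s≤s)
  import Data.Nat.Divisibility as ℕᵈ
  open import Data.Nat.DivMod using (_/_; m*n/n≡m)
  open import Data.Nat.Primality using (prime⇒irreducible)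
  open import Data.Integer using (+_; _+_; _*_; _-_)
  import Data.Integer.Properties as ℤ
  open import Data.Integer.Divisibility.Signed using (_∣_; divides; ∣⇒∣ᵤ;
    ∣m∣n⇒∣m+n; ∣m⇒∣-m; ∣n⇒∣m*n; ∣m⇒∣m*n)
  open import Data.Integer.Tactic.RingSolver using (solve-∀)
  open import Data.Nat.Tactic.RingSolver using () renaming (solve-∀ to ℕ-solve-∀)
  open import Data.Fin using (toℕ)
  open import Data.Fin.Properties using (toℕ<n)
  open import Data.Product using (∃; proj₁; proj₂; _×_)
  open import Data.Empty using (⊥-elim)
  open import Function.Bundles using (_⇔_; mk⇔)
  open import Relation.Nullary using (¬_; Dec; yes; no)
  open import Relation.Nullary.Decidable using (_⊎-dec_)
  open import Relation.Binary.PropositionalEquality using (cong₂; module ≡-Reasoning)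
  open Congruence
  open Counting using (count; count-none; count-cong; count-⊎; ∃<-suc)
  open PrimePower pr

  r-odd : Σ ℕ λ h → r ≡ suc (h ℕ.+ h)
  r-odd with parity r
  ... | h , inj₂ r≡1+h+h = h , r≡1+h+h
  ... | h , inj₁ r≡h+h with prime⇒irreducible pr (ℕᵈ.divides h (trans r≡h+h (double h)))
    where
    double : ∀ h → h ℕ.+ h ≡ h ℕ.* 2
    double = ℕ-solve-∀
  ...   | inj₁ ()
  ...   | inj₂ 2≡r = ⊥-elim (r≢2 (sym 2≡r))

  half : ℕ
  half = proj₁ r-odd

  r≡1+2half : r ≡ suc (half ℕ.+ half)
  r≡1+2half = proj₂ r-odd

  [r+1]/2≡1+half : (r ℕ.+ 1) / 2 ≡ suc half
  [r+1]/2≡1+half = trans (cong (_/ 2) (trans (cong (ℕ._+ 1) r≡1+2half) (double half))) (m*n/n≡m (suc half) 2)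
    where
    double : ∀ h → suc (h ℕ.+ h) ℕ.+ 1 ≡ suc h ℕ.* 2
    double = ℕ-solve-∀

  r∤2 : ¬ + r ∣ + 2
  r∤2 r∣2 = r≢2 (ℕ.≤-antisym (ℕᵈ.∣⇒≤ (∣⇒∣ᵤ r∣2)) 1<r)

  square-lift : ∀ {u D} v f → v < f → ¬ + r ∣ u → (u * r^ v) * (u * r^ v) ≡ D ⟨mod r^ (v ℕ.+ f) ⟩ →
                ∀ c → IsSquare (r^ suc (v ℕ.+ f)) (D + r^ (v ℕ.+ f) * c)
  -- Newton step: w = u r^v + p r^f, where 2up ≡ c − c₀ (mod r) cancels the r^(v+f) term.
  square-lift {u} {D} v f v<f r∤u (congruent (divides c₀ w₀²-D≡c₀r^e)) c with inverse-mod-r (∤-* r∤2 r∤u)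
  ... | ι , congruent r∣2uι-1 =
    w , congruent (∣-resp-≡ (∣m∣n⇒∣m+n (∣⇒r^suc∣r^* (v ℕ.+ f) (∣m⇒∣m*n (c - c₀) r∣2uι-1))
                                     (∣n⇒∣m*n (p * p) (r^-∣-* {suc (v ℕ.+ f)} {f} {f} (ℕ.+-monoˡ-≤ f v<f))))
                           (sym expand))
    where
    P = r^ v
    F = r^ f
    p = ι * (c - c₀)
    w = u * P + p * F
    ring-identity : ∀ u P F D c c₀ ι →
      (u * P + ι * (c - c₀) * F) * (u * P + ι * (c - c₀) * F) - (D + (P * F) * c) ≡
      ((u * P) * (u * P) - D - c₀ * (P * F)) +
      ((P * F) * ((+ 2 * u * ι - + 1) * (c - c₀)) + (ι * (c - c₀)) * (ι * (c - c₀)) * (F * F))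
    ring-identity = solve-∀
    vanish : (u * P) * (u * P) - D - c₀ * (P * F) ≡ + 0
    vanish = trans (cong (_- c₀ * (P * F)) (trans w₀²-D≡c₀r^e (cong (c₀ *_) (r^-+ v f)))) (ℤ.+-inverseʳ (c₀ * (P * F)))
    y = (+ 2 * u * ι - + 1) * (c - c₀)
    expand : w * w - (D + r^ (v ℕ.+ f) * c) ≡ r^ (v ℕ.+ f) * y + p * p * (F * F)
    expand = begin
      w * w - (D + r^ (v ℕ.+ f) * c)                         ≡⟨ cong (λ q → w * w - (D + q * c)) (r^-+ v f) ⟩
      w * w - (D + (P * F) * c)                              ≡⟨ ring-identity u P F D c c₀ ι ⟩
      ((u * P) * (u * P) - D - c₀ * (P * F)) + ((P * F) * y + p * p * (F * F))
                                                             ≡⟨ cong (_+ ((P * F) * y + p * p * (F * F))) vanish ⟩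
      + 0 + ((P * F) * y + p * p * (F * F))                  ≡⟨ ℤ.+-identityˡ _ ⟩
      (P * F) * y + p * p * (F * F)                          ≡⟨ cong (λ q → q * y + p * p * (F * F)) (r^-+ v f) ⟨
      r^ (v ℕ.+ f) * y + p * p * (F * F)                     ∎
      where open ≡-Reasoning

  square-representative : ∀ {c} → IsSquare (+ r) c → ∃ λ z → z < suc half × + z * + z ≡ c ⟨mod + r ⟩
  square-representative {c} (w , w²≡c) with reduce r w
  ... | f , f≡w with toℕ f ℕ.≤? half
  ...   | yes f≤half = toℕ f , s≤s f≤half , mod-trans (mod-* f≡w f≡w) w²≡c
  ...   | no  f≰half = r ℕ.∸ toℕ f , s≤s r-f≤half , mod-trans (mod-trans reflect (mod-* f≡w f≡w)) w²≡c
    where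
    r-f≤half : r ℕ.∸ toℕ f ≤ half
    r-f≤half = subst (λ q → q ℕ.∸ toℕ f ≤ half) (sym r≡1+2half)
                 (ℕ.≤-trans (ℕ.∸-monoʳ-≤ (suc (half ℕ.+ half)) (ℕ.≰⇒> f≰half))
                            (ℕ.≤-reflexive (ℕ.m+n∸m≡n half half)))
    r-f≡ : + (r ℕ.∸ toℕ f) ≡ + r - + toℕ f
    r-f≡ = trans (sym (ℤ.⊖-≥ (ℕ.<⇒≤ (toℕ<n f)))) (sym (ℤ.m-n≡m⊖n r (toℕ f)))
    difference : ∀ ρ n → (ρ - n) * (ρ - n) - n * n ≡ (ρ - + 2 * n) * ρ
    difference = solve-∀
    reflect : + (r ℕ.∸ toℕ f) * + (r ℕ.∸ toℕ f) ≡ + toℕ f * + toℕ f ⟨mod + r ⟩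
    reflect = congruent (divides (+ r - + 2 * + toℕ f)
                (trans (cong (λ q → q * q - + toℕ f * + toℕ f) r-f≡) (difference (+ r) (+ toℕ f))))

  isSquare⇔small-root : ∀ c → IsSquare (+ r) c ⇔ (∃ λ z → z < suc half × + z * + z ≡ c ⟨mod + r ⟩)
  isSquare⇔small-root c = mk⇔ square-representative (λ (z , _ , z²≡c) → + z , z²≡c)

  squares-distinct : ∀ {z z′} → z < z′ → z′ ≤ half → ¬ (+ z * + z ≡ + z′ * + z′ ⟨mod + r ⟩)
  squares-distinct {z} {z′} z<z′ z′≤half (congruent r∣z²-z′²)
    with euclid (+ z - + z′) (+ z + + z′) (∣-resp-≡ r∣z²-z′² (factor (+ z) (+ z′)))
    where
    factor : ∀ a b → a * a - b * b ≡ (a - b) * (a + b)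
    factor = solve-∀
  ... | inj₁ r∣z-z′ = ℕ.<⇒≢ z<z′ ([mod]⇒≡ z<r z′<r (⟨mod⟩⇒[mod] {z} {z′} (congruent r∣z-z′)))
    where
    z′<r : z′ < r
    z′<r = subst (z′ <_) (sym r≡1+2half) (s≤s (ℕ.≤-trans z′≤half (ℕ.m≤m+n half half)))
    z<r : z < r
    z<r = ℕ.<-trans z<z′ z′<r
  ... | inj₂ r∣z+z′ = ℕ.<⇒≢ (ℕ.<-≤-trans (ℕ.≤-<-trans z≤n z<z′) (ℕ.m≤n+m z′ z)) (sym z+z′≡0)
    where
    z+z′<r : z ℕ.+ z′ < r
    z+z′<r = subst (z ℕ.+ z′ <_) (sym r≡1+2half)
               (s≤s (ℕ.+-mono-≤ (ℕ.≤-trans (ℕ.<⇒≤ z<z′) z′≤half) z′≤half))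
    z+z′≡0 : z ℕ.+ z′ ≡ 0
    z+z′≡0 = [mod]⇒≡ z+z′<r (ℕ.≤-<-trans z≤n z+z′<r)
               (⟨mod⟩⇒[mod] {z ℕ.+ z′} {0}
                  (congruent (∣-resp-≡ r∣z+z′ (trans (sym (ℤ.pos-+ z z′)) (sym (ℤ.+-identityʳ _))))))

  count-squares : ∀ {α} → ¬ + r ∣ α → ∀ c j → j ≤ suc half →
                  count (λ s → ℕ.anyUpTo? (λ z → + z * + z ≡? c + α * + s ⟨mod + r ⟩) j) r ≡ j
  count-squares {α} r∤α c zero    _ = count-none r _ (λ s _ → λ { (_ , () , _) })
  count-squares {α} r∤α c (suc j) j<1+half = begin
    count (λ s → ℕ.anyUpTo? (root? s) (suc j)) r
      ≡⟨ count-cong r _ _ (λ s _ → ∃<-suc j) ⟩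
    count (λ s → ℕ.anyUpTo? (root? s) j ⊎-dec root? s j) r
      ≡⟨ count-⊎ r _ _ disjoint ⟩
    count (λ s → ℕ.anyUpTo? (root? s) j) r ℕ.+ count (λ s → root? s j) r
      ≡⟨ cong₂ ℕ._+_ (count-squares r∤α c j (ℕ.<⇒≤ j<1+half)) root-unique ⟩
    j ℕ.+ 1
      ≡⟨ ℕ.+-comm j 1 ⟩
    suc j ∎
    where
    open ≡-Reasoning
    Root : ℕ → ℕ → Set
    Root s z = + z * + z ≡ c + α * + s ⟨mod + r ⟩
    root? : ∀ s z → Dec (Root s z)
    root? s z = + z * + z ≡? c + α * + s ⟨mod + r ⟩
    disjoint : ∀ s → (∃ λ z → z < j × Root s z) → ¬ Root s j
    disjoint s (z , z<j , z²≡) j²≡ = squares-distinct z<j (ℕ.≤-pred j<1+half) (mod-trans z²≡ (mod-sym j²≡))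
    root-unique : count (λ s → root? s j) r ≡ 1
    root-unique = trans (count-cong r _ _ (λ s _ → mod-transpose)) (count-linear r∤α (+ j * + j - c))

module Lifting (N k : ℕ) {r : ℕ} (pr : Prime r) (r≢2 : r ≢ 2) (cop : Coprime (N ℕ.* k) r) where

  open import Data.Nat using (_≤_; _<_; z≤n; s≤s)
  open import Data.Nat.Divisibility as ℕᵈ using () renaming (_∣_ to _∣ℕ_)
  open import Data.Integer using (ℤ; +_; _+_; _*_; _-_; -_)
  import Data.Integer.Properties as ℤ
  open import Data.Integer.Divisibility.Signed using (_∣_; ∣⇒∣ᵤ; ∣-refl; ∣-trans;
    ∣m∣n⇒∣m+n; ∣m⇒∣-m; ∣n⇒∣m*n; ∣m⇒∣m*n)
  open import Data.Integer.Tactic.RingSolver using (solve-∀)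
  open import Data.Fin using (Fin; toℕ; fromℕ<)
  open import Data.Fin.Properties using (toℕ<n; toℕ-fromℕ<; fromℕ<-toℕ)
  open import Data.Product using (∃; ∃-syntax; proj₁; proj₂; _×_; map₂)
  open import Data.Empty using (⊥-elim)
  open import Function using (id)
  open import Function.Bundles using (_⇔_; mk⇔; Equivalence)
  open import Relation.Nullary using (¬_; yes; no)
  open import Relation.Nullary.Decidable using (map′)
  open import Relation.Unary using (Decidable)
  open Congruence
  open Counting using (count; count-cong; count-all; count-blocks; block-index; length-filter-tabulate)
  open import Data.Unit using (tt)
  import Function.Properties.Equivalence as ⇔
  open import Level using (0ℓ)
  import Relation.Binary.Reasoning.Setoid as SetoidReasoning
  open PrimePower pr
  open OddPrime pr r≢2

  Δ : ℤ → ℤ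
  Δ b = b * b - + 4 * + k * + N

  Representable : ℤ → ℤ → Set
  Representable m b = Σ ℤ λ x → Σ ℤ λ y → x * y ≡ + N ⟨mod m ⟩ × + k * x + y ≡ b ⟨mod m ⟩

  representable⇒square : ∀ {m b} → Representable m b → IsSquare m (Δ b)
  representable⇒square {m} {b} (x , y , congruent m∣xy-N , congruent m∣kx+y-b) =
    + k * x - y ,
    congruent (∣-resp-≡ (∣m∣n⇒∣m+n (∣m⇒∣m*n (+ k * x + y + b) m∣kx+y-b)
                                   (∣m⇒∣-m (∣n⇒∣m*n (+ 4 * + k) m∣xy-N)))
                        (identity x y b (+ k) (+ N)))
    where
    identity : ∀ x y b k N → (k * x + y - b) * (k * x + y + b) + - (+ 4 * k * (x * y - N)) ≡
                             (k * x - y) * (k * x - y) - (b * b - + 4 * k * N)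
    identity = solve-∀

  r∤Nk : ¬ r ∣ℕ N ℕ.* k
  r∤Nk r∣Nk = ℕ.<⇒≢ 1<r (sym (cop (r∣Nk , ℕᵈ.∣-refl)))

  r∤k : ¬ + r ∣ + k
  r∤k r∣k = r∤Nk (ℕᵈ.∣n⇒∣m*n N (∣⇒∣ᵤ r∣k))

  r∤N : ¬ + r ∣ + N
  r∤N r∣N = r∤Nk (ℕᵈ.∣m⇒∣m*n k (∣⇒∣ᵤ r∣N))

  r∤4kN : ¬ + r ∣ + 4 * + k * + N
  r∤4kN = ∤-* (∤-* (∤-* r∤2 r∤2) r∤k) r∤N

  square⇒representable : ∀ {n} → 1 ≤ n → ∀ {b} w → w * w ≡ Δ b ⟨mod r^ n ⟩ →
    Σ ℤ λ x → Σ ℤ λ y → (x * y ≡ + N ⟨mod r^ n ⟩ × + k * x + y ≡ b ⟨mod r^ n ⟩) ×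
                        + k * x - y ≡ w ⟨mod r^ n ⟩
  -- x = (b + w)/2k and y = (b − w)/2, using inverses g of k and h of 2 modulo r^n.
  square⇒representable {suc n} _ {b} w (congruent M∣w²-Δb) with inverse-mod-r^ r∤k n | inverse-mod-r^ r∤2 n
  ... | g , kg≡1 | h , 2h≡1 = g * (h * (b + w)) , h * (b - w) , (xy≡N , kx+y≡b) , kx-y≡w
    where
    M = r^ suc n
    K = + k
    u = h * (b + w)
    kx+y≡b : K * (g * u) + h * (b - w) ≡ b ⟨mod M ⟩
    kx+y≡b = congruent (∣-resp-≡ (∣m∣n⇒∣m+n (∣m⇒∣m*n u (m∣i-j kg≡1)) (∣m⇒∣m*n b (m∣i-j 2h≡1)))
                                 (identity K g h b w))
      where
      identity : ∀ K g h b w → (K * g - + 1) * (h * (b + w)) + (+ 2 * h - + 1) * b ≡ K * (g * (h * (b + w))) + h * (b - w) - b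
      identity = solve-∀
    kx-y≡w : K * (g * u) - h * (b - w) ≡ w ⟨mod M ⟩
    kx-y≡w = congruent (∣-resp-≡ (∣m∣n⇒∣m+n (∣m⇒∣m*n u (m∣i-j kg≡1)) (∣m⇒∣m*n w (m∣i-j 2h≡1)))
                                 (identity K g h b w))
      where
      identity : ∀ K g h b w → (K * g - + 1) * (h * (b + w)) + (+ 2 * h - + 1) * w ≡ K * (g * (h * (b + w))) - h * (b - w) - w
      identity = solve-∀
    b²-w²≡4kN : b * b - w * w ≡ + 4 * K * + N ⟨mod M ⟩
    b²-w²≡4kN = congruent (∣-resp-≡ (∣m⇒∣-m M∣w²-Δb) (identity b w K (+ N)))
      where
      identity : ∀ b w K N → - (w * w - (b * b - + 4 * K * N)) ≡ (b * b - w * w) - + 4 * K * N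
      identity = solve-∀
    xy≡N : g * u * (h * (b - w)) ≡ + N ⟨mod M ⟩
    xy≡N = begin
      g * u * (h * (b - w))                          ≡⟨ separate g h b w ⟩
      (g * (h * h)) * (b * b - w * w)                ≈⟨ mod-* (mod-refl {g * (h * h)}) b²-w²≡4kN ⟩
      (g * (h * h)) * (+ 4 * K * + N)                ≡⟨ regroup g h K (+ N) ⟩
      (K * g) * ((+ 2 * h) * ((+ 2 * h) * + N))      ≈⟨ mod-* kg≡1 (mod-* 2h≡1 (mod-* 2h≡1 (mod-refl {+ N}))) ⟩
      + 1 * (+ 1 * (+ 1 * + N))                      ≡⟨ ℤ.*-identityˡ _ ⟩
      + 1 * (+ 1 * + N)                              ≡⟨ ℤ.*-identityˡ _ ⟩
      + 1 * + N                                      ≡⟨ ℤ.*-identityˡ _ ⟩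
      + N                                            ∎
      where
      open ≡-mod-Reasoning M
      separate : ∀ g h b w → g * (h * (b + w)) * (h * (b - w)) ≡ (g * (h * h)) * (b * b - w * w)
      separate = solve-∀
      regroup : ∀ g h K N → (g * (h * h)) * (+ 4 * K * N) ≡ (K * g) * ((+ 2 * h) * ((+ 2 * h) * N))
      regroup = solve-∀

  representable⇔square : ∀ {n} → 1 ≤ n → ∀ b → Representable (r^ n) b ⇔ IsSquare (r^ n) (Δ b)
  representable⇔square {n} 1≤n b = mk⇔ representable⇒square from
    where
    from : IsSquare (r^ n) (Δ b) → Representable (r^ n) b
    from (w , w²≡Δb) = map₂ (map₂ proj₁) (square⇒representable 1≤n w w²≡Δb)

  private
    pos-linear : ∀ a b → + (k ℕ.* a ℕ.+ b) ≡ + k * + a + + b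
    pos-linear a b = trans (ℤ.pos-+ (k ℕ.* a) b) (cong (_+ + b) (ℤ.pos-* k a))

  InL⇒representable : ∀ {m} (a : Fin m) → InL N m k a → Representable (+ m) (+ toℕ a)
  InL⇒representable a (x , y , xy≡N , kx+y≡a) =
    + toℕ x , + toℕ y , mod-trans (mod-reflexive (sym (ℤ.pos-* (toℕ x) (toℕ y)))) ([mod]⇒⟨mod⟩ xy≡N) ,
                        mod-trans (mod-reflexive (sym (pos-linear (toℕ x) (toℕ y)))) ([mod]⇒⟨mod⟩ kx+y≡a)

  reduce-representation : ∀ m .{{_ : ℕ.NonZero m}} (a : Fin m) {x y} →
    x * y ≡ + N ⟨mod + m ⟩ → + k * x + y ≡ + toℕ a ⟨mod + m ⟩ →
    Σ (Fin m) λ x′ → Σ (Fin m) λ y′ →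
      InP N m k a x′ y′ × + k * + toℕ x′ - + toℕ y′ ≡ + k * x - y ⟨mod + m ⟩
  reduce-representation m a {x} {y} xy≡N kx+y≡a =
    x′ , y′ , (x′y′≡N , kx′+y′≡a) , mod-+ kx′≡kx (mod-neg y′≡y)
    where
    x′ = proj₁ (reduce m x)
    x′≡x = proj₂ (reduce m x)
    y′ = proj₁ (reduce m y)
    y′≡y = proj₂ (reduce m y)
    kx′≡kx : + k * + toℕ x′ ≡ + k * x ⟨mod + m ⟩
    kx′≡kx = mod-* (mod-refl {+ k}) x′≡x
    x′y′≡N : (toℕ x′ ℕ.* toℕ y′) ≡ N [mod m ]
    x′y′≡N = ⟨mod⟩⇒[mod] (mod-trans (mod-reflexive (ℤ.pos-* (toℕ x′) (toℕ y′)))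
                                    (mod-trans (mod-* x′≡x y′≡y) xy≡N))
    kx′+y′≡a : (k ℕ.* toℕ x′ ℕ.+ toℕ y′) ≡ toℕ a [mod m ]
    kx′+y′≡a = ⟨mod⟩⇒[mod] (mod-trans (mod-reflexive (pos-linear (toℕ x′) (toℕ y′)))
                                      (mod-trans (mod-+ kx′≡kx y′≡y) kx+y≡a))

  representable⇒InL : ∀ m .{{_ : ℕ.NonZero m}} (a : Fin m) → Representable (+ m) (+ toℕ a) → InL N m k a
  representable⇒InL m a (x , y , xy≡N , kx+y≡a) = map₂ (map₂ proj₁) (reduce-representation m a xy≡N kx+y≡a)

  [mod]⇒∣kx-y : ∀ j {a b} → (k ℕ.* a) ≡ b [mod r ℕ.^ j ] → r^ j ∣ + k * + a - + b
  [mod]⇒∣kx-y j {a} {b} d = ∣-resp-≡ (m∣i-j ([mod]⇒⟨mod⟩ {k ℕ.* a} {b} d)) (cong (_- + b) (ℤ.pos-* k a))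

  ∣kx-y⇒[mod] : ∀ j {a b} → r^ j ∣ + k * + a - + b → (k ℕ.* a) ≡ b [mod r ℕ.^ j ]
  ∣kx-y⇒[mod] j {a} {b} d = ⟨mod⟩⇒[mod] {k ℕ.* a} {b} (congruent (∣-resp-≡ d (cong (_- + b) (sym (ℤ.pos-* k a)))))

  representable-resp : ∀ {m b b′} → b ≡ b′ ⟨mod m ⟩ → Representable m b → Representable m b′
  representable-resp b≡b′ (x , y , xy≡N , kx+y≡b) = x , y , xy≡N , mod-trans kx+y≡b b≡b′

  representable-weaken : ∀ {m n b} → m ∣ n → Representable n b → Representable m b
  representable-weaken m∣n (x , y , xy≡N , kx+y≡b) = x , y , mod-weaken m∣n xy≡N , mod-weaken m∣n kx+y≡b

  reduction : ∀ e (b : Fin (r ℕ.^ suc e)) → InL N (r ℕ.^ suc e) k b →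
              ∃[ a ] (Reduces r e b a × InL N (r ℕ.^ e) k a)
  reduction e b b∈L = a , ⟨mod⟩⇒[mod] (mod-sym a≡b) ,
                      representable⇒InL (r ℕ.^ e) {{ℕ.m^n≢0 r e}} a (representable-resp (mod-sym a≡b) b∈Lₑ)
    where
    b∈Lₑ : Representable (r^ e) (+ toℕ b)
    b∈Lₑ = representable-weaken (r^-mono-∣ (ℕ.n≤1+n e)) (InL⇒representable b b∈L)
    a = proj₁ (reduce (r ℕ.^ e) {{ℕ.m^n≢0 r e}} (+ toℕ b))
    a≡b = proj₂ (reduce (r ℕ.^ e) {{ℕ.m^n≢0 r e}} (+ toℕ b))

  module _ (e : ℕ) (a : Fin (r ℕ.^ e)) where

    private
      M = r ℕ.^ e
      R = r ℕ.^ suc e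

      Lift : Fin R → Set
      Lift b = InL N R k b × Reduces r e b a

    LiftIndex : ℕ → Set
    LiftIndex i = Σ (i < R) λ i<R → Lift (fromℕ< i<R)

    LiftIndex? : Decidable LiftIndex
    LiftIndex? i with i ℕ.<? R
    ... | yes i<R = map′ (i<R ,_) proj₂ (Lift? N r e k a (fromℕ< i<R))
    ... | no  i≮R = no (λ h → i≮R (proj₁ h))

    count#≡count-shifts : count# N r e k a ≡ count (λ s → LiftIndex? (s ℕ.* M ℕ.+ toℕ a)) r
    count#≡count-shifts =
      trans (length-filter-tabulate R (Lift? N r e k a) id LiftIndex? (λ b → mk⇔ (embed b) (restrict b)))
            (count-blocks r M (toℕ<n a) LiftIndex? only-a)
      where
      embed : ∀ b → Lift b → LiftIndex (toℕ b)
      embed b lift = toℕ<n b , subst Lift (sym (fromℕ<-toℕ b (toℕ<n b))) lift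
      restrict : ∀ b → LiftIndex (toℕ b) → Lift b
      restrict b (b<R , lift) = subst Lift (fromℕ<-toℕ b b<R) lift
      only-a : ∀ s j → s < r → j < M → LiftIndex (s ℕ.* M ℕ.+ j) → j ≡ toℕ a
      only-a s j _ j<M (i<R , _ , reduces) =
        [mod]⇒≡ j<M (toℕ<n a) (block-residue s (subst (_≡ toℕ a [mod M ]) (toℕ-fromℕ< i<R) reduces))

    liftIndex⇔representable : ∀ s → s < r →
                              LiftIndex (s ℕ.* M ℕ.+ toℕ a) ⇔ Representable (r^ suc e) (+ toℕ a + + s * r^ e)
    liftIndex⇔representable s s<r = mk⇔ to from
      where
      value : ∀ (i<R : s ℕ.* M ℕ.+ toℕ a < R) → + toℕ (fromℕ< i<R) ≡ + toℕ a + + s * r^ e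
      value i<R = trans (cong +_ (toℕ-fromℕ< i<R))
                 (trans (ℤ.pos-+ (s ℕ.* M) (toℕ a))
                        (trans (cong (_+ + toℕ a) (ℤ.pos-* s M)) (ℤ.+-comm (+ s * r^ e) (+ toℕ a))))
      to : LiftIndex (s ℕ.* M ℕ.+ toℕ a) → Representable (r^ suc e) (+ toℕ a + + s * r^ e)
      to (i<R , b∈L , _) = representable-resp (mod-reflexive (value i<R)) (InL⇒representable (fromℕ< i<R) b∈L)
      from : Representable (r^ suc e) (+ toℕ a + + s * r^ e) → LiftIndex (s ℕ.* M ℕ.+ toℕ a)
      from rep = i<R ,
                 representable⇒InL R {{ℕ.m^n≢0 r (suc e)}} (fromℕ< i<R)
                   (representable-resp (mod-reflexive (sym (value i<R))) rep) ,
                 subst (_≡ toℕ a [mod M ]) (sym (toℕ-fromℕ< i<R)) (block-residue⁻ s)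
        where
        i<R : s ℕ.* M ℕ.+ toℕ a < R
        i<R = block-index s<r (toℕ<n a)

  count#≡count : ∀ e (a : Fin (r ℕ.^ e)) {T : ℕ → Set} (T? : Decidable T) →
                 (∀ s → s < r → Representable (r^ suc e) (+ toℕ a + + s * r^ e) ⇔ T s) →
                 count# N r e k a ≡ count T? r
  count#≡count e a T? lift⇔T =
    trans (count#≡count-shifts e a)
          (count-cong r _ T? (λ s s<r → ⇔.trans (liftIndex⇔representable e a s s<r) (lift⇔T s s<r)))

  Δ-shift : ∀ a s q → Δ (a + s * q) ≡ Δ a + q * (+ 2 * a * s + s * s * q)
  Δ-shift a s q = identity a s q (+ k) (+ N)
    where
    identity : ∀ a s q K N → (a + s * q) * (a + s * q) - + 4 * K * N ≡ (a * a - + 4 * K * N) + q * (+ 2 * a * s + s * s * q)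
    identity = solve-∀

  module _ {e : ℕ} (a : Fin (r ℕ.^ e)) {v : ℕ} (ν : IsNuVal N r e k a v) where

    private
      A : ℤ
      A = + toℕ a

    valuation-witness : Σ ℤ λ u → (u * r^ v) * (u * r^ v) ≡ Δ A ⟨mod r^ e ⟩ × (v < e → ¬ + r ∣ u)
    valuation-witness = u , subst (λ w → w * w ≡ Δ A ⟨mod r^ e ⟩) w₀≡ur^v w₀²≡ΔA , r∤u
      where
      x₀ = proj₁ (proj₁ ν)
      y₀ = proj₁ (proj₂ (proj₁ ν))
      x₀y₀∈P = proj₁ (proj₂ (proj₂ (proj₁ ν)))
      ν-x₀y₀ = proj₂ (proj₂ (proj₂ (proj₁ ν)))
      w₀ = + k * + toℕ x₀ - + toℕ y₀
      w₀²≡ΔA : w₀ * w₀ ≡ Δ A ⟨mod r^ e ⟩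
      w₀²≡ΔA = proj₂ (representable⇒square (InL⇒representable a (x₀ , y₀ , x₀y₀∈P)))
      r^v∣w₀ : r^ v ∣ w₀
      r^v∣w₀ = [mod]⇒∣kx-y v (proj₁ (proj₂ ν-x₀y₀))
      u = _∣_.quotient r^v∣w₀
      w₀≡ur^v : w₀ ≡ u * r^ v
      w₀≡ur^v = _∣_.equality r^v∣w₀
      r∤u : v < e → ¬ + r ∣ u
      r∤u v<e r∣u = ℕ.<-irrefl refl (proj₂ (proj₂ ν-x₀y₀) (suc v) v<e (∣kx-y⇒[mod] (suc v) r^suc∣w₀))
        where
        r^suc∣w₀ : r^ suc v ∣ w₀
        r^suc∣w₀ = ∣-resp-≡ (∣⇒r^suc∣r^* v r∣u) (trans (ℤ.*-comm (r^ v) u) (sym w₀≡ur^v))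

    every-shift-lifts : v ℕ.+ v < e → ∀ s → Representable (r^ suc e) (A + + s * r^ e)
    every-shift-lifts 2v<e s =
      Equivalence.from (representable⇔square {suc e} (s≤s z≤n) (A + + s * r^ e))
        (isSquare-resp (mod-reflexive (sym (Δ-shift A (+ s) (r^ e))))
                       (subst (λ i → IsSquare (r^ suc i) (Δ A + r^ i * c)) v+f≡e lifted))
      where
      u = proj₁ valuation-witness
      v<e : v < e
      v<e = ℕ.m+n≤o⇒m≤o (suc v) 2v<e
      f = e ℕ.∸ v
      v+f≡e : v ℕ.+ f ≡ e
      v+f≡e = ℕ.m+[n∸m]≡n (ℕ.<⇒≤ v<e)
      c = + 2 * A * + s + + s * + s * r^ e
      lifted : IsSquare (r^ suc (v ℕ.+ f)) (Δ A + r^ (v ℕ.+ f) * c)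
      lifted = square-lift v f (ℕ.m+n≤o⇒m≤o∸n (suc v) 2v<e) (proj₂ (proj₂ valuation-witness) v<e)
                 (subst (λ i → (u * r^ v) * (u * r^ v) ≡ Δ A ⟨mod r^ i ⟩) (sym v+f≡e)
                        (proj₁ (proj₂ valuation-witness))) c

    module _ (1≤e : 1 ≤ e) (e≤2v : e ≤ v ℕ.+ v) where

      r^e∣ΔA : r^ e ∣ Δ A
      r^e∣ΔA = ∣-resp-≡ (∣m∣n⇒∣m+n r^e∣w² (∣m⇒∣-m (m∣i-j w²≡ΔA))) (cancel (w * w) (Δ A))
        where
        u = proj₁ valuation-witness
        w = u * r^ v
        w²≡ΔA = proj₁ (proj₂ valuation-witness)
        regroup : ∀ u P → (u * u) * (P * P) ≡ (u * P) * (u * P)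
        regroup = solve-∀
        r^e∣w² : r^ e ∣ w * w
        r^e∣w² = ∣-resp-≡ (∣n⇒∣m*n (u * u) (r^-∣-* {e} {v} {v} e≤2v)) (regroup u (r^ v))
        cancel : ∀ a b → a + - (a - b) ≡ b
        cancel = solve-∀

      private
        d : ℤ
        d = _∣_.quotient r^e∣ΔA

        α : ℤ
        α = + 2 * A

        coefficient : ℕ → ℤ
        coefficient s = d + (+ 2 * A * + s + + s * + s * r^ e)

      r∣r^e : + r ∣ r^ e
      r∣r^e = subst (_∣ r^ e) r^1 (r^-mono-∣ 1≤e)

      r∤α : ¬ + r ∣ α
      r∤α = ∤-* r∤2 r∤A
        where
        r∤A : ¬ + r ∣ A
        r∤A r∣A = r∤4kN (∣-resp-≡ (∣m∣n⇒∣m+n (∣m⇒∣m*n A r∣A) (∣m⇒∣-m (∣-trans r∣r^e r^e∣ΔA)))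
                                  (cancel A (+ k) (+ N)))
          where
          cancel : ∀ a k N → a * a + - (a * a - + 4 * k * N) ≡ + 4 * k * N
          cancel = solve-∀

      Δ-lift≡ : ∀ s → Δ (A + + s * r^ e) ≡ r^ e * coefficient s
      Δ-lift≡ s = trans (Δ-shift A (+ s) (r^ e))
                        (trans (cong (_+ r^ e * shift) (_∣_.equality r^e∣ΔA)) (factor d (r^ e) shift))
        where
        shift = + 2 * A * + s + + s * + s * r^ e
        factor : ∀ d q x → d * q + q * x ≡ q * (d + x)
        factor = solve-∀

      coefficient≡ : ∀ s → coefficient s ≡ d + α * + s ⟨mod + r ⟩
      coefficient≡ s = congruent (∣-resp-≡ (∣n⇒∣m*n (+ s * + s) r∣r^e) (sym (difference d A (+ s) (r^ e))))
        where
        difference : ∀ d A s q → d + (+ 2 * A * s + s * s * q) - (d + + 2 * A * s) ≡ s * s * q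
        difference = solve-∀

      lift⇔isSquare : ∀ s → Representable (r^ suc e) (A + + s * r^ e) ⇔ IsSquare (r^ suc e) (r^ e * coefficient s)
      lift⇔isSquare s = ⇔.trans (representable⇔square {suc e} (s≤s z≤n) (A + + s * r^ e))
                                 (isSquare-cong (mod-reflexive (Δ-lift≡ s)))

      lift⇔small-root : e ≡ v ℕ.+ v → ∀ s → Representable (r^ suc e) (A + + s * r^ e) ⇔
                        (∃ λ z → z < suc half × + z * + z ≡ d + α * + s ⟨mod + r ⟩)
      lift⇔small-root e≡2v s = begin
        Representable (r^ suc e) (A + + s * r^ e)                 ≈⟨ lift⇔isSquare s ⟩
        IsSquare (r^ suc e) (r^ e * coefficient s)                ≈⟨ isSquare-r^even v e≡2v (coefficient s) ⟩
        IsSquare (+ r) (coefficient s)                            ≈⟨ isSquare-cong (coefficient≡ s) ⟩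
        IsSquare (+ r) (d + α * + s)                              ≈⟨ isSquare⇔small-root (d + α * + s) ⟩
        (∃ λ z → z < suc half × + z * + z ≡ d + α * + s ⟨mod + r ⟩) ∎
        where open SetoidReasoning (⇔.⇔-setoid 0ℓ)

      lift⇔linear : ∀ t → e ≡ suc (t ℕ.+ t) → ∀ s →
                    Representable (r^ suc e) (A + + s * r^ e) ⇔ α * + s ≡ - d ⟨mod + r ⟩
      lift⇔linear t e≡1+2t s = begin
        Representable (r^ suc e) (A + + s * r^ e)                 ≈⟨ lift⇔isSquare s ⟩
        IsSquare (r^ suc e) (r^ e * coefficient s)                ≈⟨ isSquare-r^odd t e≡1+2t (coefficient s) ⟩
        + r ∣ coefficient s                                       ≈⟨ ∣-cong (coefficient≡ s) ⟩
        + r ∣ d + α * + s                                         ≈⟨ ∣m+n⇔n≡-m ⟩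
        α * + s ≡ - d ⟨mod + r ⟩                                  ∎
        where open SetoidReasoning (⇔.⇔-setoid 0ℓ)

      exponent-odd : e < v ℕ.+ v → Σ ℕ λ t → e ≡ suc (t ℕ.+ t)
      exponent-odd e<2v with parity e
      ... | t , inj₂ e≡1+2t = t , e≡1+2t
      ... | t , inj₁ e≡2t  = ⊥-elim (ℕ.<⇒≱ e<2v (subst (v ℕ.+ v ≤_) (sym e≡2t) (ℕ.+-mono-≤ v≤t v≤t)))
        where
        t<e : t < e
        t<e = subst (t <_) (sym e≡2t) (ℕ.m<m+n t (ℕ.n≢0⇒n>0 t≢0))
          where
          t≢0 : t ≢ 0
          t≢0 t≡0 = ℕ.<⇒≱ (subst (1 ≤_) e≡2t 1≤e) (ℕ.≤-reflexive (cong (λ x → x ℕ.+ x) t≡0))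
        w = r^ t
        w²≡ΔA : w * w ≡ Δ A ⟨mod r^ e ⟩
        w²≡ΔA = congruent (∣-resp-≡ (∣m∣n⇒∣m+n (∣-refl {r^ e}) (∣m⇒∣-m r^e∣ΔA))
                                    (cong (_- Δ A) (trans (cong r^_ e≡2t) (r^-+ t t))))
        representation = square⇒representable 1≤e w w²≡ΔA
        reduced = reduce-representation (r ℕ.^ e) {{ℕ.m^n≢0 r e}} a
                    (proj₁ (proj₁ (proj₂ (proj₂ representation)))) (proj₂ (proj₁ (proj₂ (proj₂ representation))))
        x′ = proj₁ reduced
        y′ = proj₁ (proj₂ reduced)
        kx′-y′≡r^t : + k * + toℕ x′ - + toℕ y′ ≡ r^ t ⟨mod r^ e ⟩
        kx′-y′≡r^t = mod-trans (proj₂ (proj₂ (proj₂ reduced))) (proj₂ (proj₂ (proj₂ representation)))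
        ν-x′y′ : IsNu r e k x′ y′ t
        ν-x′y′ = ℕ.<⇒≤ t<e , ∣kx-y⇒[mod] t (≡r^t⇒r^t∣ (ℕ.<⇒≤ t<e) kx′-y′≡r^t) ,
                 λ i _ r^i∣ → ≡r^t⇒exponent≤ t<e kx′-y′≡r^t i ([mod]⇒∣kx-y i r^i∣)
        v≤t : v ≤ t
        v≤t = proj₂ ν x′ y′ (proj₁ (proj₂ (proj₂ reduced))) t ν-x′y′

      count-at : e ≡ v ℕ.+ v → count# N r e k a ≡ suc half
      count-at e≡2v =
        trans (count#≡count e a (λ s → ℕ.anyUpTo? (λ z → + z * + z ≡? d + α * + s ⟨mod + r ⟩) (suc half))
                                (λ s _ → lift⇔small-root e≡2v s))
              (count-squares r∤α d (suc half) ℕ.≤-refl)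

      count-above : e < v ℕ.+ v → count# N r e k a ≡ 1
      count-above e<2v =
        trans (count#≡count e a (λ s → α * + s ≡? - d ⟨mod + r ⟩)
                                (λ s _ → lift⇔linear (proj₁ (exponent-odd e<2v)) (proj₂ (exponent-odd e<2v)) s))
              (count-linear r∤α (- d))

    count-below : v ℕ.+ v < e → count# N r e k a ≡ r
    count-below 2v<e =
      trans (count#≡count e a (λ _ → yes tt) (λ s _ → mk⇔ (λ _ → tt) (λ _ → every-shift-lifts 2v<e s)))
            (count-all r _ (λ _ _ → tt))

open import Data.Nat using (_+_; _*_; _^_; _≤_; _<_)
open import Data.Nat.DivMod using (_/_)
open import Data.Fin using (Fin)
open import Data.Product using (∃-syntax; _×_)

lemma7p2 : (N k e r : ℕ) → 1 ≤ e → Prime r → r ≢ 2 → Coprime (N * k) r →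
    ((b : Fin (r ^ (1 + e))) → InL N (r ^ (1 + e)) k b →
       ∃[ a ] (Reduces r e b a × InL N (r ^ e) k a)) ×
    ((a : Fin (r ^ e)) → InL N (r ^ e) k a → (v : ℕ) → IsNuVal N r e k a v →
       (2 * v < e → count# N r e k a ≡ r) ×
       (2 * v ≡ e → count# N r e k a ≡ (r + 1) / 2) ×
       (e < 2 * v → count# N r e k a ≡ 1))
lemma7p2 N k e r 1≤e pr r≢2 cop = reduction e , λ a _ v ν →  -- a ∈ L_{N,r^e,k} already follows from ν
  (λ 2v<e → count-below a ν (subst (_< e) (2*v≡v+v v) 2v<e)) ,
  (λ 2v≡e → let e≡v+v = trans (sym 2v≡e) (2*v≡v+v v) in
            trans (count-at a ν 1≤e (ℕ.≤-reflexive e≡v+v) e≡v+v) (sym [r+1]/2≡1+half)) ,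
  (λ e<2v → let e<v+v = subst (e <_) (2*v≡v+v v) e<2v in
            count-above a ν 1≤e (ℕ.<⇒≤ e<v+v) e<v+v)
  where
  open Lifting N k pr r≢2 cop
  open OddPrime pr r≢2 using ([r+1]/2≡1+half)
  2*v≡v+v : ∀ v → 2 * v ≡ v + v
  2*v≡v+v v = cong (v +_) (ℕ.+-identityʳ v)
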